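{- Let $\mathbb{F}_{16}=\mathbb{F}_2[\alpha]$ with $\alpha^4+\alpha+1=0$, let $W=\{u\in\mathbb{F}_{16};\ u+u^2+u^4+u^8=0\}$ (a $3$-dimensional $\mathbb{F}_2$-subspace of $\mathbb{F}_{16}$), and take $V=W\times\mathbb{F}_{16}\cong\mathbb{F}_2^7$ as ambient $\mathbb{F}_2$-vector space. For $a_0,a_1\in\mathbb{F}_{16}$ let $G(a_0,a_1)=\{(x,a_0x+a_1x^2);\ x\in W\}$, a $3$-dimensional subspace of $V$, and let $\mathcal{L}=\{G(a_0,a_1);\ a_0,a_1\in\mathbb{F}_{16}\}$ ($256$ subspaces). Let $S=\{0\}\times\mathbb{F}_{16}$ (a $4$-dimensional subspace). Let $\mathcal{S}_0,\dots,\mathcal{S}_6$ be a partition of the set of all $35$ two-dimensional subspaces of $S$ into $7$ spreads, each $\mathcal{S}_i$ consisting of $5$ pairwise trivially intersecting $2$-dimensional subspaces of $S$ (such a parallelism exists). Let $p_0,\dots,p_6$ be $1$-dimensional subspaces of $V$ such that the seven $5$-dimensional subspaces $p_i+S$ are pairwise distinct. Then the set $\mathcal{C}=\mathcal{L}\cup\{p_i+L;\ 0\le i\le 6,\ L\in\mathcal{S}_i\}$ consists of $291$ distinct $3$-dimensional subspaces of $V$ and has minimum subspace distance $\min\{d_S(U,U');\ U,U'\in\mathcal{C},\ U\neq U'\}=4$, i.e. it is a binary $(7,291,4;3)$ subspace code.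
   Context: The subspace distance of subspaces $U,V$ is $d_S(U,V)=\dim(U+V)-\dim(U\cap V)$; for two $3$-dimensional subspaces it equals $6-2\dim(U\cap V)$. A binary $(v,M,d;k)$ subspace code is a set of $M$ distinct $k$-dimensional subspaces of $\mathbb{F}_2^v$ with minimum pairwise subspace distance $d$. -}

module Defs where

open import Data.Bool using (Bool; true; false; _xor_; if_then_else_)
open import Data.Nat using (ℕ; _∸_)
open import Data.Fin using (Fin)
open import Data.Vec using (Vec; []; _∷_; replicate)
open import Data.Product using (Σ; ∃; ∃₂; _×_; _,_; proj₁; proj₂)
open import Data.Sum using (_⊎_; inj₁; inj₂)
open import Relation.Binary.PropositionalEquality using (_≡_)

-- The field F16 = F2[α], α⁴ + α + 1 = 0.
-- mk b0 b1 b2 b3 represents b0 + b1 α + b2 α² + b3 α³.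

data F16 : Set where
  mk : Bool → Bool → Bool → Bool → F16

0F : F16
0F = mk false false false false

infixl 6 _+F_
infixl 7 _*F_

_+F_ : F16 → F16 → F16
mk a0 a1 a2 a3 +F mk b0 b1 b2 b3 = mk (a0 xor b0) (a1 xor b1) (a2 xor b2) (a3 xor b3)

-- multiplication by α, using α⁴ = α + 1
mulα : F16 → F16
mulα (mk b0 b1 b2 b3) = mk b3 (b0 xor b3) b1 b2

scaleF : Bool → F16 → F16
scaleF c x = if c then x else 0F

_*F_ : F16 → F16 → F16
x *F mk c0 c1 c2 c3 =
  scaleF c0 x +F scaleF c1 (mulα x) +F scaleF c2 (mulα (mulα x))
    +F scaleF c3 (mulα (mulα (mulα x)))

sq : F16 → F16
sq u = u *F u

W : F16 → Set
W u = u +F sq u +F sq (sq u) +F sq (sq (sq u)) ≡ 0F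

-- Vectors are pairs in F16 × F16 (an F2-space of dim 8);
-- V = W × F16 is the subset InV.  Subspaces of V are predicates that are
-- contained in InV (and are subspaces, which HasDim guarantees).

Vect : Set
Vect = F16 × F16

0V : Vect
0V = 0F , 0F

_+V_ : Vect → Vect → Vect
(a , b) +V (c , d) = (a +F c) , (b +F d)

InV : Vect → Set
InV x = W (proj₁ x)

Subset : Set₁
Subset = Vect → Set

_⊆_ : Subset → Subset → Set
U ⊆ U' = ∀ x → U x → U' x

_≐_ : Subset → Subset → Set
U ≐ U' = ∀ x → (U x → U' x) × (U' x → U x)

_⊕_ : Subset → Subset → Subset
(U ⊕ U') x = ∃₂ λ u u' → U u × U' u' × x ≡ u +V u'

_∩_ : Subset → Subset → Subset
(U ∩ U') x = U x × U' x

lincomb : ∀ {k} → Vec Bool k → Vec Vect k → Vect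
lincomb [] [] = 0V
lincomb (c ∷ cs) (v ∷ vs) = (if c then v else 0V) +V lincomb cs vs

Span : ∀ {k} → Vec Vect k → Subset
Span {k} b x = Σ (Vec Bool k) λ c → lincomb c b ≡ x

Independent : ∀ {k} → Vec Vect k → Set
Independent {k} b = ∀ c → lincomb c b ≡ 0V → c ≡ replicate k false

HasDim : Subset → ℕ → Set
HasDim U k = Σ (Vec Vect k) λ b → Independent b × (U ≐ Span b)

SubDist : Subset → Subset → ℕ → Set
SubDist U U' n = ∃₂ λ a b → HasDim (U ⊕ U') a × HasDim (U ∩ U') b × n ≡ a ∸ b

G : F16 → F16 → Subset
G a0 a1 y = ∃ λ x → W x × y ≡ (x , a0 *F x +F a1 *F sq x)

S : Subset
S y = proj₁ y ≡ 0F

-- Index set of the code: 16·16 = 256 lifted codewords plus 7·5 = 35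
-- codewords p_i + L, L ∈ 𝒮_i;  in total 291 indices.
CodeIndex : Set
CodeIndex = (F16 × F16) ⊎ (Fin 7 × Fin 5)

-- the code 𝒞, given points p_i and the parallelism (𝒮_i = {Ls i j ; j})
code : (Fin 7 → Subset) → (Fin 7 → Fin 5 → Subset) → CodeIndex → Subset
code p Ls (inj₁ (a0 , a1)) = G a0 a1
code p Ls (inj₂ (i , j))   = p i ⊕ Ls i j

-- Over F₂, two 3-dimensional subspaces sharing at most one nonzero vector are distinct and at
-- subspace distance 6 or 4, according as they meet trivially or in a line; so it suffices that
-- any two codewords share at most one nonzero vector.  For G(a) ≠ G(b), the first coordinate x
-- of a common nonzero vector is a nonzero root of (a₀+b₀)x + (a₁+b₁)x² = x((a₀+b₀) + (a₁+b₁)x),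
-- and as F16 has no zero divisors there is at most one.  Writing p_i = ⟨q_i⟩, the vectors of
-- p_i + L have first coordinate 0 or that of q_i, which is nonzero because dim(p_i + S) = 5 >
-- dim S, and different for different i because the p_i + S differ.  So G(a) ∩ (p_i + L) has at
-- most one nonzero vector, (p_i + L) ∩ (p_i + L') ⊆ {0, q_i} for disjoint L, L', and
-- (p_i + L) ∩ (p_j + L') ⊆ L ∩ L' for i ≠ j, where two distinct planes share at most one nonzero
-- vector.  Distance exactly 4 is attained by G(0,0) and G(1,1), which share (1, 0).

module Submission where

open import Defs
open import Algebra.Bundles using (AbelianGroup)
open import Algebra.Core using (Op₂)
open import Algebra.Definitions using (Associative; Commutative; LeftIdentity)
import Algebra.Properties.AbelianGroup as AbelianGroupProperties
import Algebra.Properties.CommutativeSemigroup as CommutativeSemigroupProperties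
open import Algebra.Structures using (IsAbelianGroup)
open import Data.Bool using (Bool; true; false; _xor_; if_then_else_)
import Data.Bool.Properties as Boolₚ
open import Data.Fin as Fin using (Fin; zero; suc)
import Data.Fin.Properties as Finₚ
open import Data.Nat using (ℕ; _+_; _∸_; _^_; _≤_; _≤?_)
open import Data.Nat.Properties using (≤-refl; m≤m+n)
open import Data.Product using (∃; ∃₂; _×_; _,_; proj₁; proj₂)
import Data.Product.Properties as Productₚ
open import Data.Sum as Sum using (_⊎_; inj₁; inj₂; [_,_]′)
open import Data.Vec as Vec using (Vec; []; _∷_; replicate; zipWith; map; _++_; lookup; insertAt; removeAt)
import Data.Vec.Properties as Vecₚ
open import Function using (id; _∘_)
open import Function.Definitions using (Injective)
open import Level using (0ℓ)
open import Relation.Binary.Definitions using (DecidableEquality)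
open import Relation.Binary.PropositionalEquality
  using (_≡_; _≢_; refl; sym; trans; cong; cong₂; subst; isEquivalence; module ≡-Reasoning)
open import Relation.Nullary using (Dec; yes; no; ¬_; contradiction)
open import Relation.Nullary.Decidable
  using (map′; _×-dec_; _⊎-dec_; _→-dec_; ¬?; from-yes; from-no; decidable-stable)
open import Relation.Unary using (Decidable)

-- Exhaustive quantification over small finite types

allBool? : {P : Bool → Set} → Decidable P → Dec (∀ b → P b)
allBool? P? = map′ (λ { (t , f) true → t ; (t , f) false → f }) (λ h → h true , h false)
                   (P? true ×-dec P? false)

anyBool? : {P : Bool → Set} → Decidable P → Dec (∃ P)
anyBool? P? = map′ (λ { (inj₁ t) → true , t ; (inj₂ f) → false , f })
                   (λ { (true , t) → inj₁ t ; (false , f) → inj₂ f })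
                   (P? true ⊎-dec P? false)

allF16? : {P : F16 → Set} → Decidable P → Dec (∀ x → P x)
allF16? P? = map′ (λ h → λ { (mk a b c d) → h a b c d }) (λ h a b c d → h (mk a b c d))
  (allBool? λ a → allBool? λ b → allBool? λ c → allBool? λ d → P? (mk a b c d))

allVec? : ∀ {n} {P : Vec Bool n → Set} → Decidable P → Dec (∀ c → P c)
allVec? {ℕ.zero}  P? = map′ (λ { p [] → p }) (λ h → h []) (P? [])
allVec? {ℕ.suc n} P? = map′ (λ { h (b ∷ c) → h b c }) (λ h b c → h (b ∷ c))
  (allBool? λ b → allVec? λ c → P? (b ∷ c))

anyVec? : ∀ {n} {P : Vec Bool n → Set} → Decidable P → Dec (∃ P)
anyVec? {ℕ.zero}  P? = map′ ([] ,_) (λ { ([] , p) → p }) (P? [])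
anyVec? {ℕ.suc n} P? = map′ (λ { (b , c , p) → b ∷ c , p }) (λ { (b ∷ c , p) → b , c , p })
  (anyBool? λ b → anyVec? λ c → P? (b ∷ c))

infix 4 _≟F_ _≟V_ _≟B_

_≟F_ : DecidableEquality F16
mk a b c d ≟F mk a' b' c' d' =
  map′ (λ { (refl , refl , refl , refl) → refl }) (λ { refl → refl , refl , refl , refl })
       (a Boolₚ.≟ a' ×-dec b Boolₚ.≟ b' ×-dec c Boolₚ.≟ c' ×-dec d Boolₚ.≟ d')

_≟V_ : DecidableEquality Vect
_≟V_ = Productₚ.≡-dec _≟F_ _≟F_

_≟B_ : ∀ {n} → DecidableEquality (Vec Bool n)
_≟B_ = Vecₚ.≡-dec Boolₚ._≟_

zeros : ∀ {n} → Vec Bool n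
zeros = replicate _ false

module ElementaryAbelian {A : Set} (_∙_ : Op₂ A) (ε : A)
  (assoc : Associative _≡_ _∙_) (comm : Commutative _≡_ _∙_)
  (identityˡ : LeftIdentity _≡_ ε _∙_) (same : ∀ x → x ∙ x ≡ ε) where

  isAbelianGroup : IsAbelianGroup _≡_ _∙_ ε id
  isAbelianGroup = record
    { isGroup = record
      { isMonoid = record
        { isSemigroup = record
          { isMagma = record { isEquivalence = isEquivalence ; ∙-cong = cong₂ _∙_ }
          ; assoc = assoc }
        ; identity = identityˡ , λ x → trans (comm x ε) (identityˡ x) }
      ; inverse = same , same
      ; ⁻¹-cong = cong id }
    ; comm = comm }

  abelianGroup : AbelianGroup 0ℓ 0ℓ
  abelianGroup = record { isAbelianGroup = isAbelianGroup }

  open AbelianGroup abelianGroup public using (identityʳ)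
  open AbelianGroupProperties abelianGroup public using (inverseˡ-unique)
  open CommutativeSemigroupProperties (AbelianGroup.commutativeSemigroup abelianGroup) public
    using (interchange; x∙yz≈y∙xz)

  cancelˡ : ∀ x y → x ∙ (x ∙ y) ≡ y
  cancelˡ x y = trans (sym (assoc x x y)) (trans (cong (_∙ y) (same x)) (identityˡ y))

  ∙≡⇒≡∙ : ∀ {x y z} → x ∙ y ≡ z → x ≡ z ∙ y
  ∙≡⇒≡∙ {x} {y} refl = trans (sym (identityʳ x)) (trans (cong (x ∙_) (sym (same y))) (sym (assoc x y y)))

-- Arithmetic of F16

φ : F16 → F16 → F16 → F16
φ a0 a1 x = a0 *F x +F a1 *F sq x

-- Opaque, so that the exhaustive checks are not re-run wherever these facts are used.
opaque
  +F-comm : ∀ x y → x +F y ≡ y +F x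
  +F-comm = from-yes (allF16? λ x → allF16? λ y → x +F y ≟F y +F x)

  +F-assoc : ∀ x y z → (x +F y) +F z ≡ x +F (y +F z)
  +F-assoc = from-yes (allF16? λ x → allF16? λ y → allF16? λ z → (x +F y) +F z ≟F x +F (y +F z))

  +F-identityˡ : ∀ x → 0F +F x ≡ x
  +F-identityˡ = from-yes (allF16? λ x → 0F +F x ≟F x)

  +F-same : ∀ x → x +F x ≡ 0F
  +F-same = from-yes (allF16? λ x → x +F x ≟F 0F)

  *F-zeroˡ : ∀ x → 0F *F x ≡ 0F
  *F-zeroˡ = from-yes (allF16? λ x → 0F *F x ≟F 0F)

  *F-distribˡ-+F : ∀ a x y → a *F (x +F y) ≡ a *F x +F a *F y
  *F-distribˡ-+F = from-yes (allF16? λ a → allF16? λ x → allF16? λ y →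
    a *F (x +F y) ≟F a *F x +F a *F y)

  *F-distribʳ-+F : ∀ x a b → (a +F b) *F x ≡ a *F x +F b *F x
  *F-distribʳ-+F = from-yes (allF16? λ x → allF16? λ a → allF16? λ b →
    (a +F b) *F x ≟F a *F x +F b *F x)

  *F-noZeroDivisors : ∀ x y → x *F y ≡ 0F → x ≡ 0F ⊎ y ≡ 0F
  *F-noZeroDivisors = from-yes (allF16? λ x → allF16? λ y →
    (x *F y ≟F 0F) →-dec (x ≟F 0F ⊎-dec y ≟F 0F))

  sq-+F : ∀ x y → sq (x +F y) ≡ sq x +F sq y
  sq-+F = from-yes (allF16? λ x → allF16? λ y → sq (x +F y) ≟F sq x +F sq y)

  φ-factor : ∀ c0 c1 x → φ c0 c1 x ≡ x *F (c0 +F c1 *F x)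
  φ-factor = from-yes (allF16? λ c0 → allF16? λ c1 → allF16? λ x → φ c0 c1 x ≟F x *F (c0 +F c1 *F x))

module +F = ElementaryAbelian _+F_ 0F +F-assoc +F-comm +F-identityˡ +F-same

*F-cancelˡ : ∀ {c x y} → c ≢ 0F → c *F x ≡ c *F y → x ≡ y
*F-cancelˡ {c} {x} {y} c≢0 cx≡cy =
  [ (λ c≡0 → contradiction c≡0 c≢0) , +F.inverseˡ-unique x y ]′ (*F-noZeroDivisors c (x +F y) c[x+y]≡0)
  where
  c[x+y]≡0 : c *F (x +F y) ≡ 0F
  c[x+y]≡0 = trans (*F-distribˡ-+F c x y) (trans (cong (_+F c *F y) cx≡cy) (+F-same _))

φ-+F : ∀ a0 a1 x y → φ a0 a1 (x +F y) ≡ φ a0 a1 x +F φ a0 a1 y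
φ-+F a0 a1 x y = begin
  a0 *F (x +F y) +F a1 *F sq (x +F y)
    ≡⟨ cong₂ _+F_ (*F-distribˡ-+F a0 x y)
                  (trans (cong (a1 *F_) (sq-+F x y)) (*F-distribˡ-+F a1 (sq x) (sq y))) ⟩
  (a0 *F x +F a0 *F y) +F (a1 *F sq x +F a1 *F sq y)
    ≡⟨ +F.interchange _ _ _ _ ⟩
  φ a0 a1 x +F φ a0 a1 y ∎
  where open ≡-Reasoning

φ-+coeff : ∀ a0 a1 b0 b1 x → φ a0 a1 x +F φ b0 b1 x ≡ φ (a0 +F b0) (a1 +F b1) x
φ-+coeff a0 a1 b0 b1 x = begin
  φ a0 a1 x +F φ b0 b1 x                              ≡⟨ +F.interchange _ _ _ _ ⟩
  (a0 *F x +F b0 *F x) +F (a1 *F sq x +F b1 *F sq x)  ≡⟨ cong₂ _+F_ (sym (*F-distribʳ-+F x a0 b0))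
                                                                   (sym (*F-distribʳ-+F (sq x) a1 b1)) ⟩
  φ (a0 +F b0) (a1 +F b1) x ∎
  where open ≡-Reasoning

φ-nonzeroRoot : ∀ {c0 c1 z} → z ≢ 0F → φ c0 c1 z ≡ 0F → c1 *F z ≡ c0
φ-nonzeroRoot {c0} {c1} {z} z≢0 φz≡0
  with *F-noZeroDivisors z (c0 +F c1 *F z) (trans (sym (φ-factor c0 c1 z)) φz≡0)
... | inj₁ z≡0   = contradiction z≡0 z≢0
... | inj₂ sum≡0 = sym (+F.inverseˡ-unique c0 (c1 *F z) sum≡0)

φ-nonzeroRoot-unique : ∀ {c0 c1 x y} → (c0 , c1) ≢ (0F , 0F) → x ≢ 0F → y ≢ 0F →
  φ c0 c1 x ≡ 0F → φ c0 c1 y ≡ 0F → x ≡ y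
φ-nonzeroRoot-unique {c0} {c1} {x} {y} c≢0 x≢0 y≢0 φx≡0 φy≡0 =
  *F-cancelˡ c1≢0 (trans c1x≡c0 (sym (φ-nonzeroRoot y≢0 φy≡0)))
  where
  c1x≡c0 : c1 *F x ≡ c0
  c1x≡c0 = φ-nonzeroRoot x≢0 φx≡0
  c1≢0 : c1 ≢ 0F
  c1≢0 c1≡0 = c≢0 (cong₂ _,_ (trans (sym c1x≡c0) (trans (cong (_*F x) c1≡0) (*F-zeroˡ x))) c1≡0)

-- F₂-linear algebra in Vect

+V-assoc : ∀ x y z → (x +V y) +V z ≡ x +V (y +V z)
+V-assoc x y z = cong₂ _,_ (+F-assoc _ _ _) (+F-assoc _ _ _)

+V-comm : ∀ x y → x +V y ≡ y +V x
+V-comm x y = cong₂ _,_ (+F-comm _ _) (+F-comm _ _)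

+V-identityˡ : ∀ x → 0V +V x ≡ x
+V-identityˡ x = cong₂ _,_ (+F-identityˡ _) (+F-identityˡ _)

+V-same : ∀ x → x +V x ≡ 0V
+V-same x = cong₂ _,_ (+F-same _) (+F-same _)

module +V = ElementaryAbelian _+V_ 0V +V-assoc +V-comm +V-identityˡ +V-same

sel : Bool → Vect → Vect
sel c v = if c then v else 0V

sel-xor : ∀ c d v → sel c v +V sel d v ≡ sel (c xor d) v
sel-xor true  true  v = +V-same v
sel-xor true  false v = +V.identityʳ v
sel-xor false true  v = +V-identityˡ v
sel-xor false false v = +V-same 0V

sel-+V : ∀ c x y → sel c (x +V y) ≡ sel c x +V sel c y
sel-+V true  x y = refl
sel-+V false x y = sym (+V-same 0V)

lincomb-zeros : ∀ {k} (b : Vec Vect k) → lincomb zeros b ≡ 0V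
lincomb-zeros []      = refl
lincomb-zeros (v ∷ b) = trans (+V-identityˡ _) (lincomb-zeros b)

lincomb-xor : ∀ {k} (c d : Vec Bool k) (b : Vec Vect k) →
  lincomb c b +V lincomb d b ≡ lincomb (zipWith _xor_ c d) b
lincomb-xor []       []       []      = +V-same 0V
lincomb-xor (c ∷ cs) (d ∷ ds) (v ∷ b) =
  trans (+V.interchange _ _ _ _) (cong₂ _+V_ (sel-xor c d v) (lincomb-xor cs ds b))

lincomb-++ : ∀ {k l} (c : Vec Bool k) (d : Vec Bool l) (b : Vec Vect k) (b' : Vec Vect l) →
  lincomb (c ++ d) (b ++ b') ≡ lincomb c b +V lincomb d b'
lincomb-++ []       d []      b' = sym (+V-identityˡ _)
lincomb-++ (c ∷ cs) d (v ∷ b) b' =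
  trans (cong (sel c v +V_) (lincomb-++ cs d b b')) (sym (+V-assoc _ _ _))

lincomb-insertAt : ∀ {k} (d : Vec Bool k) (i : Fin (ℕ.suc k)) (c : Bool) (b : Vec Vect (ℕ.suc k)) →
  lincomb (insertAt d i c) b ≡ sel c (lookup b i) +V lincomb d (removeAt b i)
lincomb-insertAt d       zero    c (x ∷ b)         = refl
lincomb-insertAt (e ∷ d) (suc i) c (x ∷ b@(_ ∷ _)) =
  trans (cong (sel e x +V_) (lincomb-insertAt d i c b)) (+V.x∙yz≈y∙xz _ _ _)

xor≡zeros⇒≡ : ∀ {k} (c d : Vec Bool k) → zipWith _xor_ c d ≡ zeros → c ≡ d
xor≡zeros⇒≡ []          []          _  = refl
xor≡zeros⇒≡ (true ∷ c)  (true ∷ d)  eq = cong (true ∷_) (xor≡zeros⇒≡ c d (Vecₚ.∷-injectiveʳ eq))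
xor≡zeros⇒≡ (false ∷ c) (false ∷ d) eq = cong (false ∷_) (xor≡zeros⇒≡ c d (Vecₚ.∷-injectiveʳ eq))

lincomb-injective : ∀ {k} (b : Vec Vect k) → Independent b →
  ∀ c d → lincomb c b ≡ lincomb d b → c ≡ d
lincomb-injective b b-ind c d eq =
  xor≡zeros⇒≡ c d (b-ind _ (trans (sym (lincomb-xor c d b)) (trans (cong (_+V lincomb d b) eq) (+V-same _))))

coordinates-nonzero : ∀ {k} {c : Vec Bool k} (b : Vec Vect k) → lincomb c b ≢ 0V → c ≢ zeros
coordinates-nonzero b lincomb≢0 refl = lincomb≢0 (lincomb-zeros b)

insertAt-false≡zeros : ∀ {k} (d : Vec Bool k) i → insertAt d i false ≡ zeros → d ≡ zeros
insertAt-false≡zeros d       zero    eq = Vecₚ.∷-injectiveʳ eq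
insertAt-false≡zeros (e ∷ d) (suc i) eq =
  cong₂ _∷_ (Vecₚ.∷-injectiveˡ eq) (insertAt-false≡zeros d i (Vecₚ.∷-injectiveʳ eq))

nonzero⇒lookup≡true : ∀ {n} (c : Vec Bool n) → c ≢ zeros → ∃ λ i → lookup c i ≡ true
nonzero⇒lookup≡true []          c≢0 = contradiction refl c≢0
nonzero⇒lookup≡true (true ∷ c)  _   = zero , refl
nonzero⇒lookup≡true (false ∷ c) c≢0 =
  let i , cᵢ≡true = nonzero⇒lookup≡true c (c≢0 ∘ cong (false ∷_)) in suc i , cᵢ≡true

replicate-++ : ∀ k l → zeros {k} ++ zeros {l} ≡ zeros
replicate-++ ℕ.zero    l = refl
replicate-++ (ℕ.suc k) l = cong (false ∷_) (replicate-++ k l)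

Span-0 : ∀ {k} (b : Vec Vect k) → Span b 0V
Span-0 b = zeros , lincomb-zeros b

Span-+ : ∀ {k} (b : Vec Vect k) {x y} → Span b x → Span b y → Span b (x +V y)
Span-+ b (c , refl) (d , refl) = zipWith _xor_ c d , sym (lincomb-xor c d b)

Span-sel : ∀ {k} (b : Vec Vect k) c {x} → Span b x → Span b (sel c x)
Span-sel b true  x∈ = x∈
Span-sel b false _  = Span-0 b

Span-line : ∀ {q x} → Span (q ∷ []) x → x ≡ 0V ⊎ x ≡ q
Span-line     (false ∷ [] , refl) = inj₁ refl
Span-line {q} (true ∷ []  , refl) = inj₂ (+V.identityʳ q)

line-independent : ∀ {v} → v ≢ 0V → Independent (v ∷ [])
line-independent {v} v≢0 (true ∷ [])  eq = contradiction (trans (sym (+V.identityʳ v)) eq) v≢0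
line-independent     v≢0 (false ∷ []) eq = refl

HasDim-0 : ∀ {U k} → HasDim U k → U 0V
HasDim-0 (b , _ , U≐) = proj₂ (U≐ _) (Span-0 b)

HasDim-+ : ∀ {U k x y} → HasDim U k → U x → U y → U (x +V y)
HasDim-+ (b , _ , U≐) x∈ y∈ = proj₂ (U≐ _) (Span-+ b (proj₁ (U≐ _) x∈) (proj₁ (U≐ _) y∈))

HasDim1⇒line : ∀ {P} → HasDim P 1 → ∃ λ q → P ≐ Span (q ∷ [])
HasDim1⇒line (q ∷ [] , _ , P≐) = q , P≐

≐-refl : ∀ {U} → U ≐ U
≐-refl _ = id , id

⊕-span : ∀ {k l} {U U' : Subset} (b : Vec Vect k) (b' : Vec Vect l) →
  U ≐ Span b → U' ≐ Span b' → (U ⊕ U') ≐ Span (b ++ b')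
⊕-span {k} {U = U} {U'} b b' U≐ U'≐ x = to , from
  where
  to : (U ⊕ U') x → Span (b ++ b') x
  to (u , u' , u∈ , u'∈ , refl) with proj₁ (U≐ u) u∈ | proj₁ (U'≐ u') u'∈
  ... | c , refl | d , refl = c ++ d , lincomb-++ c d b b'
  from : Span (b ++ b') x → (U ⊕ U') x
  from (cd , refl) with Vec.splitAt k cd
  ... | c , d , refl =
    lincomb c b , lincomb d b' , proj₂ (U≐ _) (c , refl) , proj₂ (U'≐ _) (d , refl) , lincomb-++ c d b b'

-- Subspaces meeting in at most a line

AtMostOneNonzero : Subset → Set
AtMostOneNonzero X = ∀ {x y} → X x → X y → x ≢ 0V → y ≢ 0V → x ≡ y

AtMostOneNonzero-intro : ∀ {X} v → (∀ {z} → X z → z ≢ 0V → z ≡ v) → AtMostOneNonzero X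
AtMostOneNonzero-intro v ≡v x∈ y∈ x≢0 y≢0 = trans (≡v x∈ x≢0) (sym (≡v y∈ y≢0))

AtMostOneNonzero-∩-comm : ∀ {U U'} → AtMostOneNonzero (U ∩ U') → AtMostOneNonzero (U' ∩ U)
AtMostOneNonzero-∩-comm meet (x∈U' , x∈U) (y∈U' , y∈U) = meet (x∈U , x∈U') (y∈U , y∈U')

AtMostOneNonzero⇒≉ : ∀ {U U' k} → HasDim U (ℕ.suc (ℕ.suc k)) → AtMostOneNonzero (U ∩ U') → ¬ (U ≐ U')
AtMostOneNonzero⇒≉ {U} {U'} {k} (u , u-ind , U≐) meet U≐U' =
  e₁≢e₂ (lincomb-injective u u-ind e₁ e₂ (meet (∈∩ e₁) (∈∩ e₂) (nonzero e₁ λ ()) (nonzero e₂ λ ())))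
  where
  e₁ e₂ : Vec Bool (ℕ.suc (ℕ.suc k))
  e₁ = true ∷ false ∷ zeros
  e₂ = false ∷ true ∷ zeros
  e₁≢e₂ : e₁ ≢ e₂
  e₁≢e₂ ()
  ∈∩ : ∀ c → (U ∩ U') (lincomb c u)
  ∈∩ c = let c∈U = proj₂ (U≐ _) (c , refl) in c∈U , proj₁ (U≐U' _) c∈U
  nonzero : ∀ c → c ≢ zeros → lincomb c u ≢ 0V
  nonzero c c≢0 = c≢0 ∘ u-ind c

∩-trivial-or-nonzero : ∀ {U U' k l} → HasDim U k → HasDim U' l →
  (∀ x → (U ∩ U') x → x ≡ 0V) ⊎ ∃ λ v → (U ∩ U') v × v ≢ 0V
∩-trivial-or-nonzero (u , _ , U≐) (u' , _ , U'≐)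
  with anyVec? (λ c → anyVec? (λ c' → (lincomb c u ≟V lincomb c' u') ×-dec ¬? (lincomb c u ≟V 0V)))
... | yes (c , c' , eq , nz) = inj₂ (lincomb c u , (proj₂ (U≐ _) (c , refl) , proj₂ (U'≐ _) (c' , sym eq)) , nz)
... | no none = inj₁ λ x (x∈U , x∈U') → decidable-stable (x ≟V 0V) λ x≢0 →
  let c , c≡ = proj₁ (U≐ x) x∈U
      c' , c'≡ = proj₁ (U'≐ x) x∈U'
  in none (c , c' , trans c≡ (sym c'≡) , λ eq → x≢0 (trans (sym c≡) eq))

subDist-trivialMeet : ∀ {U U' k l} → HasDim U k → HasDim U' l →
  (∀ x → (U ∩ U') x → x ≡ 0V) → SubDist U U' (k + l)
subDist-trivialMeet {U} {U'} {k} {l} U-dim@(u , u-ind , U≐) U'-dim@(u' , u'-ind , U'≐) trivial =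
  k + l , 0 , (u ++ u' , independent , ⊕-span u u' U≐ U'≐) , ([] , (λ { [] _ → refl }) , meet≐0) , refl
  where
  independent : Independent (u ++ u')
  independent cd eq with Vec.splitAt k cd
  ... | c , d , refl = trans (cong₂ _++_ (u-ind c z≡0) (u'-ind d (trans (sym common) z≡0))) (replicate-++ k l)
    where
    common : lincomb c u ≡ lincomb d u'
    common = +V.inverseˡ-unique _ _ (trans (sym (lincomb-++ c d u u')) eq)
    z≡0 : lincomb c u ≡ 0V
    z≡0 = trivial _ (proj₂ (U≐ _) (c , refl) , proj₂ (U'≐ _) (d , sym common))
  meet≐0 : (U ∩ U') ≐ Span []
  meet≐0 x = (λ x∈ → [] , sym (trivial x x∈)) , λ { ([] , refl) → HasDim-0 U-dim , HasDim-0 U'-dim }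

-- If U ∩ U' = {0, v}, write v = Σ cᵢ u'ᵢ and pick a pivot i with cᵢ = 1: replacing u'ᵢ by v
-- leaves a basis of U', so the basis of U together with the other u'ⱼ is a basis of U + U'.
module LineMeet {U U' : Subset} {k l} (u : Vec Vect k) (u' : Vec Vect (ℕ.suc l))
  (u-ind : Independent u) (U≐ : U ≐ Span u) (u'-ind : Independent u') (U'≐ : U' ≐ Span u')
  (meet : AtMostOneNonzero (U ∩ U')) {v} (v∈U : U v) (v∈U' : U' v) (v≢0 : v ≢ 0V) where

  c' : Vec Bool (ℕ.suc l)
  c' = proj₁ (proj₁ (U'≐ v) v∈U')

  c'-lincomb : lincomb c' u' ≡ v
  c'-lincomb = proj₂ (proj₁ (U'≐ v) v∈U')

  pivot : Fin (ℕ.suc l)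
  pivot = proj₁ (nonzero⇒lookup≡true c' (coordinates-nonzero u' (v≢0 ∘ trans (sym c'-lincomb))))

  c'-pivot : lookup c' pivot ≡ true
  c'-pivot = proj₂ (nonzero⇒lookup≡true c' (coordinates-nonzero u' (v≢0 ∘ trans (sym c'-lincomb))))

  rest : Vec Vect l
  rest = removeAt u' pivot

  lincomb-pivot : ∀ e → lincomb e u' ≡ sel (lookup e pivot) (lookup u' pivot) +V lincomb (removeAt e pivot) rest
  lincomb-pivot e = begin
    lincomb e u'
      ≡⟨ cong (λ c → lincomb c u') (Vecₚ.insertAt-removeAt e pivot) ⟨
    lincomb (insertAt (removeAt e pivot) pivot (lookup e pivot)) u'
      ≡⟨ lincomb-insertAt (removeAt e pivot) pivot (lookup e pivot) u' ⟩
    sel (lookup e pivot) (lookup u' pivot) +V lincomb (removeAt e pivot) rest ∎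
    where open ≡-Reasoning

  lincomb-rest : ∀ d → lincomb d rest ≡ lincomb (insertAt d pivot false) u'
  lincomb-rest d = sym (trans (lincomb-insertAt d pivot false u') (+V-identityˡ _))

  rest⊆U' : Span rest ⊆ U'
  rest⊆U' _ (d , refl) = proj₂ (U'≐ _) (insertAt d pivot false , sym (lincomb-rest d))

  pivot-vector : lookup u' pivot ≡ v +V lincomb (removeAt c' pivot) rest
  pivot-vector = +V.∙≡⇒≡∙ (begin
    lookup u' pivot +V lincomb (removeAt c' pivot) rest
      ≡⟨ cong (λ c → sel c (lookup u' pivot) +V lincomb (removeAt c' pivot) rest) c'-pivot ⟨
    sel (lookup c' pivot) (lookup u' pivot) +V lincomb (removeAt c' pivot) rest
      ≡⟨ lincomb-pivot c' ⟨
    lincomb c' u'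
      ≡⟨ c'-lincomb ⟩
    v ∎)
    where open ≡-Reasoning

  U'-decompose : ∀ {y} → U' y → ∃₂ λ e w → Span rest w × y ≡ sel e v +V w
  U'-decompose {y} y∈U' with proj₁ (U'≐ y) y∈U'
  ... | e , refl = eᵢ , sel eᵢ r +V lincomb (removeAt e pivot) rest ,
    Span-+ rest (Span-sel rest eᵢ (removeAt c' pivot , refl)) (removeAt e pivot , refl) , (begin
      lincomb e u'
        ≡⟨ lincomb-pivot e ⟩
      sel eᵢ (lookup u' pivot) +V lincomb (removeAt e pivot) rest
        ≡⟨ cong (λ z → sel eᵢ z +V lincomb (removeAt e pivot) rest) pivot-vector ⟩
      sel eᵢ (v +V r) +V lincomb (removeAt e pivot) rest
        ≡⟨ cong (_+V lincomb (removeAt e pivot) rest) (sel-+V eᵢ v r) ⟩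
      (sel eᵢ v +V sel eᵢ r) +V lincomb (removeAt e pivot) rest
        ≡⟨ +V-assoc _ _ _ ⟩
      sel eᵢ v +V (sel eᵢ r +V lincomb (removeAt e pivot) rest) ∎)
    where
    open ≡-Reasoning
    eᵢ = lookup e pivot
    r = lincomb (removeAt c' pivot) rest

  sum≐ : (U ⊕ U') ≐ Span (u ++ rest)
  sum≐ x = to , from
    where
    to : (U ⊕ U') x → Span (u ++ rest) x
    to (a , b , a∈U , b∈U' , refl) with U'-decompose b∈U'
    ... | e , w , w∈ , refl = proj₁ (⊕-span u rest U≐ ≐-refl _)
      (a +V sel e v , w , HasDim-+ (u , u-ind , U≐) a∈U (proj₂ (U≐ _) (Span-sel u e (proj₁ (U≐ v) v∈U))) ,
       w∈ , sym (+V-assoc _ _ _))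
    from : Span (u ++ rest) x → (U ⊕ U') x
    from x∈ with proj₂ (⊕-span u rest U≐ ≐-refl x) x∈
    ... | a , w , a∈U , w∈ , eq = a , w , a∈U , rest⊆U' w w∈ , eq

  coordinates-zero : ∀ c d → lincomb c u ≡ lincomb d rest → c ≡ zeros × d ≡ zeros
  coordinates-zero c d common with lincomb c u ≟V 0V
  ... | yes z≡0 = u-ind c z≡0 ,
    insertAt-false≡zeros d pivot (u'-ind _ (trans (sym (lincomb-rest d)) (trans (sym common) z≡0)))
  ... | no z≢0 = contradiction false≡true λ ()
    where
    open ≡-Reasoning
    z≡v : lincomb c u ≡ v
    z≡v = meet (proj₂ (U≐ _) (c , refl) , rest⊆U' _ (d , sym common)) (v∈U , v∈U') z≢0 v≢0
    d↦c' : insertAt d pivot false ≡ c'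
    d↦c' = lincomb-injective u' u'-ind _ _ (begin
      lincomb (insertAt d pivot false) u' ≡⟨ lincomb-rest d ⟨
      lincomb d rest                      ≡⟨ common ⟨
      lincomb c u                         ≡⟨ z≡v ⟩
      v                                   ≡⟨ c'-lincomb ⟨
      lincomb c' u'                       ∎)
    false≡true : false ≡ true
    false≡true = begin
      false                                ≡⟨ Vecₚ.insertAt-lookup d pivot false ⟨
      lookup (insertAt d pivot false) pivot ≡⟨ cong (λ c → lookup c pivot) d↦c' ⟩
      lookup c' pivot                      ≡⟨ c'-pivot ⟩
      true                                 ∎

  sum-independent : Independent (u ++ rest)
  sum-independent cd eq with Vec.splitAt k cd
  ... | c , d , refl =
    let c≡0 , d≡0 = coordinates-zero c d (+V.inverseˡ-unique _ _ (trans (sym (lincomb-++ c d u rest)) eq))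
    in trans (cong₂ _++_ c≡0 d≡0) (replicate-++ k l)

  meet≐line : (U ∩ U') ≐ Span (v ∷ [])
  meet≐line x = to (x ≟V 0V) , from
    where
    to : Dec (x ≡ 0V) → (U ∩ U') x → Span (v ∷ []) x
    to (yes refl) _  = false ∷ [] , refl
    to (no x≢0)   x∈ = true ∷ [] , trans (+V.identityʳ v) (meet (v∈U , v∈U') x∈ v≢0 x≢0)
    from : Span (v ∷ []) x → (U ∩ U') x
    from x∈ with Span-line x∈
    ... | inj₁ refl = HasDim-0 (u , u-ind , U≐) , HasDim-0 (u' , u'-ind , U'≐)
    ... | inj₂ refl = v∈U , v∈U'

subDist-lineMeet : ∀ {U U' k l v} → HasDim U k → HasDim U' (ℕ.suc l) → AtMostOneNonzero (U ∩ U') →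
  (U ∩ U') v → v ≢ 0V → SubDist U U' (k + l ∸ 1)
subDist-lineMeet {k = k} {l} {v} (u , u-ind , U≐) (u' , u'-ind , U'≐) meet (v∈U , v∈U') v≢0 =
  k + l , 1 , (u ++ rest , sum-independent , sum≐) , (v ∷ [] , line-independent v≢0 , meet≐line) , refl
  where open LineMeet u u' u-ind U≐ u'-ind U'≐ meet v∈U v∈U' v≢0

subDist≥4 : ∀ {U U'} → HasDim U 3 → HasDim U' 3 → AtMostOneNonzero (U ∩ U') →
  ∃ λ n → SubDist U U' n × 4 ≤ n
subDist≥4 {U} {U'} U-dim U'-dim meet = by-cases (∩-trivial-or-nonzero U-dim U'-dim)
  where
  by-cases : (∀ x → (U ∩ U') x → x ≡ 0V) ⊎ (∃ λ v → (U ∩ U') v × v ≢ 0V) → ∃ λ n → SubDist U U' n × 4 ≤ n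
  by-cases (inj₁ trivial)         = 6 , subDist-trivialMeet U-dim U'-dim trivial , m≤m+n 4 2
  by-cases (inj₂ (v , v∈ , v≢0)) = 4 , subDist-lineMeet U-dim U'-dim meet v∈ v≢0 , ≤-refl

opaque
  F₂²-cover : ∀ (c d e : Vec Bool 2) → c ≢ zeros → d ≢ zeros → c ≢ d →
    e ≡ zeros ⊎ e ≡ c ⊎ e ≡ d ⊎ e ≡ zipWith _xor_ c d
  F₂²-cover = from-yes (allVec? {2} λ c → allVec? {2} λ d → allVec? {2} λ e →
    ¬? (c ≟B zeros) →-dec ¬? (d ≟B zeros) →-dec ¬? (c ≟B d) →-dec
    (e ≟B zeros ⊎-dec e ≟B c ⊎-dec e ≟B d ⊎-dec e ≟B zipWith _xor_ c d))

plane-cover : ∀ {L x y z} → HasDim L 2 → L x → L y → x ≢ 0V → y ≢ 0V → x ≢ y → L z →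
  z ≡ 0V ⊎ z ≡ x ⊎ z ≡ y ⊎ z ≡ x +V y
plane-cover {L} {x} {y} {z} (b , _ , L≐) x∈ y∈ x≢0 y≢0 x≢y z∈
  with proj₁ (L≐ x) x∈ | proj₁ (L≐ y) y∈ | proj₁ (L≐ z) z∈
... | c , refl | d , refl | e , refl
  with F₂²-cover c d e (coordinates-nonzero b x≢0) (coordinates-nonzero b y≢0) (x≢y ∘ cong (λ c → lincomb c b))
... | inj₁ refl               = inj₁ (lincomb-zeros b)
... | inj₂ (inj₁ refl)        = inj₂ (inj₁ refl)
... | inj₂ (inj₂ (inj₁ refl)) = inj₂ (inj₂ (inj₁ refl))
... | inj₂ (inj₂ (inj₂ refl)) = inj₂ (inj₂ (inj₂ (sym (lincomb-xor c d b))))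

plane-⊆ : ∀ {L L' x y k} → HasDim L 2 → HasDim L' k → (L ∩ L') x → (L ∩ L') y →
  x ≢ 0V → y ≢ 0V → x ≢ y → L ⊆ L'
plane-⊆ L-dim L'-dim (x∈L , x∈L') (y∈L , y∈L') x≢0 y≢0 x≢y z z∈L
  with plane-cover L-dim x∈L y∈L x≢0 y≢0 x≢y z∈L
... | inj₁ refl               = HasDim-0 L'-dim
... | inj₂ (inj₁ refl)        = x∈L'
... | inj₂ (inj₂ (inj₁ refl)) = y∈L'
... | inj₂ (inj₂ (inj₂ refl)) = HasDim-+ L'-dim x∈L' y∈L'

plane-meet : ∀ {L L'} → HasDim L 2 → HasDim L' 2 → ¬ (L ≐ L') → AtMostOneNonzero (L ∩ L')
plane-meet L-dim L'-dim L≉L' {x} {y} x∈@(x∈L , x∈L') y∈@(y∈L , y∈L') x≢0 y≢0 =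
  decidable-stable (x ≟V y) λ x≢y → L≉L' λ z →
    plane-⊆ L-dim L'-dim x∈ y∈ x≢0 y≢0 x≢y z ,
    plane-⊆ L'-dim L-dim (x∈L' , x∈L) (y∈L' , y∈L) x≢0 y≢0 x≢y z

-- Counting

fromFin2 : Fin 2 → Bool
fromFin2 zero    = false
fromFin2 (suc _) = true

toFin2 : Bool → Fin 2
toFin2 false = zero
toFin2 true  = suc zero

fromFin2-injective : Injective _≡_ _≡_ fromFin2
fromFin2-injective {zero}       {zero}       _ = refl
fromFin2-injective {suc zero}   {suc zero}   _ = refl

toFin2-injective : Injective _≡_ _≡_ toFin2
toFin2-injective {false} {false} _ = refl
toFin2-injective {true}  {true}  _ = refl

binary : ∀ n → Fin (2 ^ n) → Vec Bool n
binary ℕ.zero    _ = []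
binary (ℕ.suc n) i = fromFin2 (Fin.quotient (2 ^ n) i) ∷ binary n (Fin.remainder {2} (2 ^ n) i)

binary-injective : ∀ n → Injective _≡_ _≡_ (binary n)
binary-injective ℕ.zero    {zero} {zero} _ = refl
binary-injective (ℕ.suc n) {i}    {j}    eq = begin
  i
    ≡⟨ Finₚ.combine-remQuot {2} (2 ^ n) i ⟨
  Fin.combine (Fin.quotient (2 ^ n) i) (Fin.remainder {2} (2 ^ n) i)
    ≡⟨ cong₂ Fin.combine (fromFin2-injective (Vecₚ.∷-injectiveˡ eq))
                         (binary-injective n (Vecₚ.∷-injectiveʳ eq)) ⟩
  Fin.combine (Fin.quotient (2 ^ n) j) (Fin.remainder {2} (2 ^ n) j)
    ≡⟨ Finₚ.combine-remQuot {2} (2 ^ n) j ⟩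
  j ∎
  where open ≡-Reasoning

unbinary : ∀ {n} → Vec Bool n → Fin (2 ^ n)
unbinary []      = zero
unbinary (b ∷ c) = Fin.combine (toFin2 b) (unbinary c)

unbinary-injective : ∀ {n} → Injective _≡_ _≡_ (unbinary {n})
unbinary-injective {ℕ.zero}  {[]}    {[]}      _  = refl
unbinary-injective {ℕ.suc n} {b ∷ c} {b' ∷ c'} eq =
  let b≡b' , c≡c' = Finₚ.combine-injective (toFin2 b) (unbinary c) (toFin2 b') (unbinary c') eq
  in cong₂ _∷_ (toFin2-injective b≡b') (unbinary-injective c≡c')

injective⇒2^≤2^ : ∀ {m n} {f : Vec Bool m → Vec Bool n} → Injective _≡_ _≡_ f → 2 ^ m ≤ 2 ^ n
injective⇒2^≤2^ {m} {n} f-inj =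
  Finₚ.injective⇒≤ (binary-injective m ∘ f-inj ∘ unbinary-injective {n})

toBits : F16 → Vec Bool 4
toBits (mk a b c d) = a ∷ b ∷ c ∷ d ∷ []

toBits-injective : Injective _≡_ _≡_ toBits
toBits-injective {mk _ _ _ _} {mk _ _ _ _} refl = refl

dim-⊆S : ∀ {U k} → HasDim U k → U ⊆ S → 2 ^ k ≤ 2 ^ 4
dim-⊆S {U} (b , b-ind , U≐) U⊆S = injective⇒2^≤2^ {f = toBits ∘ proj₂ ∘ (λ c → lincomb c b)} inj
  where
  first≡0 : ∀ c → proj₁ (lincomb c b) ≡ 0F
  first≡0 c = U⊆S _ (proj₂ (U≐ _) (c , refl))
  inj : Injective _≡_ _≡_ (toBits ∘ proj₂ ∘ (λ c → lincomb c b))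
  inj {c} {d} eq = lincomb-injective b b-ind c d
    (cong₂ _,_ (trans (first≡0 c) (sym (first≡0 d))) (toBits-injective eq))

-- The codewords G(a₀, a₁)

W? : Decidable W
W? u = u +F sq u +F sq (sq u) +F sq (sq (sq u)) ≟F 0F

lincombF : ∀ {k} → Vec Bool k → Vec F16 k → F16
lincombF []       []       = 0F
lincombF (c ∷ cs) (w ∷ ws) = (if c then w else 0F) +F lincombF cs ws

wBasis : Vec F16 3
wBasis = mk true false false false ∷ mk false true false false ∷ mk false false true false ∷ []

opaque
  W-spanned : ∀ x → W x → ∃ λ c → lincombF c wBasis ≡ x
  W-spanned = from-yes (allF16? λ x → W? x →-dec anyVec? {3} λ c → lincombF c wBasis ≟F x)

  wBasis-⊆W : ∀ c → W (lincombF c wBasis)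
  wBasis-⊆W = from-yes (allVec? {3} λ c → W? (lincombF c wBasis))

  wBasis-independent : ∀ c → lincombF c wBasis ≡ 0F → c ≡ zeros
  wBasis-independent = from-yes (allVec? {3} λ c → lincombF c wBasis ≟F 0F →-dec c ≟B zeros)

graph : F16 → F16 → F16 → Vect
graph a0 a1 x = x , φ a0 a1 x

lincomb-graph : ∀ {k} a0 a1 (c : Vec Bool k) (w : Vec F16 k) →
  lincomb c (map (graph a0 a1) w) ≡ graph a0 a1 (lincombF c w)
lincomb-graph a0 a1 []       []       = refl
lincomb-graph a0 a1 (c ∷ cs) (w ∷ ws) =
  trans (cong₂ _+V_ (sel-graph c) (lincomb-graph a0 a1 cs ws))
        (sym (cong (_ ,_) (φ-+F a0 a1 (if c then w else 0F) (lincombF cs ws))))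
  where
  sel-graph : ∀ c → sel c (graph a0 a1 w) ≡ graph a0 a1 (if c then w else 0F)
  sel-graph true  = refl
  sel-graph false = refl

G-dim : ∀ a0 a1 → HasDim (G a0 a1) 3
G-dim a0 a1 = map (graph a0 a1) wBasis , independent , G≐
  where
  independent : Independent (map (graph a0 a1) wBasis)
  independent c eq = wBasis-independent c (cong proj₁ (trans (sym (lincomb-graph a0 a1 c wBasis)) eq))
  G≐ : G a0 a1 ≐ Span (map (graph a0 a1) wBasis)
  G≐ y = to , from
    where
    to : G a0 a1 y → Span (map (graph a0 a1) wBasis) y
    to (x , x∈W , refl) =
      let c , c↦x = W-spanned x x∈W in c , trans (lincomb-graph a0 a1 c wBasis) (cong (graph a0 a1) c↦x)
    from : Span (map (graph a0 a1) wBasis) y → G a0 a1 y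
    from (c , refl) = lincombF c wBasis , wBasis-⊆W c , lincomb-graph a0 a1 c wBasis

G-⊆InV : ∀ a0 a1 → G a0 a1 ⊆ InV
G-⊆InV a0 a1 _ (x , x∈W , refl) = x∈W

G-meet : ∀ {a0 a1 b0 b1} → (a0 , a1) ≢ (b0 , b1) → AtMostOneNonzero (G a0 a1 ∩ G b0 b1)
G-meet {a0} {a1} {b0} {b1} a≢b ((x , _ , refl) , (_ , _ , x∈G')) ((y , _ , refl) , (_ , _ , y∈G')) x≢0 y≢0 =
  cong (graph a0 a1) (φ-nonzeroRoot-unique a+b≢0 (x≢0 ∘ cong (graph a0 a1)) (y≢0 ∘ cong (graph a0 a1))
                                           (root x∈G') (root y∈G'))
  where
  a+b≢0 : (a0 +F b0 , a1 +F b1) ≢ (0F , 0F)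
  a+b≢0 eq = a≢b (cong₂ _,_ (+F.inverseˡ-unique _ _ (cong proj₁ eq)) (+F.inverseˡ-unique _ _ (cong proj₂ eq)))
  root : ∀ {x x'} → graph a0 a1 x ≡ graph b0 b1 x' → φ (a0 +F b0) (a1 +F b1) x ≡ 0F
  root {x} eq = begin
    φ (a0 +F b0) (a1 +F b1) x ≡⟨ φ-+coeff a0 a1 b0 b1 x ⟨
    φ a0 a1 x +F φ b0 b1 x    ≡⟨ cong (_+F φ b0 b1 x) (trans (cong proj₂ eq) (cong (φ b0 b1) (sym (cong proj₁ eq)))) ⟩
    φ b0 b1 x +F φ b0 b1 x    ≡⟨ +F-same _ ⟩
    0F                        ∎
    where open ≡-Reasoning

-- Codewords p + L with L ⊆ S

proj₁-+S : ∀ a l → S l → proj₁ (a +V l) ≡ proj₁ a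
proj₁-+S a l l∈S = trans (cong (proj₁ a +F_) l∈S) (+F.identityʳ _)

⊕-split : ∀ {P L q z} → P ≐ Span (q ∷ []) → L ⊆ S → (P ⊕ L) z →
  (L z × proj₁ z ≡ 0F) ⊎ (L (q +V z) × proj₁ z ≡ proj₁ q)
⊕-split {L = L} {q} P≐ L⊆S (a , l , a∈P , l∈L , refl) with Span-line (proj₁ (P≐ a) a∈P)
... | inj₁ refl = inj₁ (subst L (sym (+V-identityˡ l)) l∈L , proj₁-+S 0V l (L⊆S l l∈L))
... | inj₂ refl = inj₂ (subst L (sym (+V.cancelˡ q l)) l∈L , proj₁-+S q l (L⊆S l l∈L))

⊕-dim : ∀ {P L q k} → P ≐ Span (q ∷ []) → proj₁ q ≢ 0F → HasDim L k → L ⊆ S → HasDim (P ⊕ L) (ℕ.suc k)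
⊕-dim {q = q} P≐ q₁≢0 (b , b-ind , L≐) L⊆S = q ∷ b , independent , ⊕-span (q ∷ []) b P≐ L≐
  where
  independent : Independent (q ∷ b)
  independent (false ∷ c) eq = cong (false ∷_) (b-ind c (trans (sym (+V-identityˡ _)) eq))
  independent (true ∷ c)  eq =
    contradiction (trans (sym (proj₁-+S q (lincomb c b) (L⊆S _ (proj₂ (L≐ _) (c , refl))))) (cong proj₁ eq)) q₁≢0

⊕-⊆InV : ∀ {P L} → P ⊆ InV → L ⊆ S → (P ⊕ L) ⊆ InV
⊕-⊆InV P⊆V L⊆S _ (a , l , a∈P , l∈L , refl) = subst W (sym (proj₁-+S a l (L⊆S l l∈L))) (P⊆V a a∈P)

⊕S⇒proj₁ : ∀ {P q z} → P ≐ Span (q ∷ []) → (P ⊕ S) z → proj₁ z ≡ 0F ⊎ proj₁ z ≡ proj₁ q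
⊕S⇒proj₁ P≐ z∈ with ⊕-split P≐ (λ _ → id) z∈
... | inj₁ (_ , z₁≡0)  = inj₁ z₁≡0
... | inj₂ (_ , z₁≡q₁) = inj₂ z₁≡q₁

proj₁⇒⊕S : ∀ {P q z} → P ≐ Span (q ∷ []) → proj₁ z ≡ 0F ⊎ proj₁ z ≡ proj₁ q → (P ⊕ S) z
proj₁⇒⊕S     {z = z} P≐ (inj₁ z₁≡0)  = 0V , z , proj₂ (P≐ 0V) (Span-0 _) , z₁≡0 , sym (+V-identityˡ z)
proj₁⇒⊕S {q = q} {z} P≐ (inj₂ z₁≡q₁) =
  q , q +V z , proj₂ (P≐ q) (true ∷ [] , +V.identityʳ q) ,
  trans (cong (proj₁ q +F_) z₁≡q₁) (+F-same _) , sym (+V.cancelˡ q z)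

⊕S-≐ : ∀ {P P' q q'} → P ≐ Span (q ∷ []) → P' ≐ Span (q' ∷ []) → proj₁ q ≡ proj₁ q' → (P ⊕ S) ≐ (P' ⊕ S)
⊕S-≐ P≐ P'≐ q₁≡q'₁ z =
  proj₁⇒⊕S P'≐ ∘ Sum.map₂ (λ e → trans e q₁≡q'₁) ∘ ⊕S⇒proj₁ P≐ ,
  proj₁⇒⊕S P≐ ∘ Sum.map₂ (λ e → trans e (sym q₁≡q'₁)) ∘ ⊕S⇒proj₁ P'≐

generator∉S : ∀ {P q} → P ≐ Span (q ∷ []) → HasDim (P ⊕ S) 5 → proj₁ q ≢ 0F
generator∉S P≐ P⊕S-dim q₁≡0 = from-no (2 ^ 5 ≤? 2 ^ 4) (dim-⊆S P⊕S-dim P⊕S⊆S)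
  where
  P⊕S⊆S : (_ ⊕ S) ⊆ S
  P⊕S⊆S _ z∈ = [ id , (λ z₁≡q₁ → trans z₁≡q₁ q₁≡0) ]′ (⊕S⇒proj₁ P≐ z∈)

AtMostOneNonzero-⊆ : ∀ {X Y} → X ⊆ Y → AtMostOneNonzero Y → AtMostOneNonzero X
AtMostOneNonzero-⊆ X⊆Y meet x∈ y∈ = meet (X⊆Y _ x∈) (X⊆Y _ y∈)

G-⊕-meet : ∀ {a0 a1 P L q} → P ≐ Span (q ∷ []) → L ⊆ S → AtMostOneNonzero (G a0 a1 ∩ (P ⊕ L))
G-⊕-meet {a0} {a1} {P} {L} {q} P≐ L⊆S = AtMostOneNonzero-intro (graph a0 a1 (proj₁ q)) on-graph
  where
  on-graph : ∀ {z} → (G a0 a1 ∩ (P ⊕ L)) z → z ≢ 0V → z ≡ graph a0 a1 (proj₁ q)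
  on-graph ((x , _ , refl) , z∈) z≢0 with ⊕-split P≐ L⊆S z∈
  ... | inj₁ (_ , x≡0)  = contradiction (cong (graph a0 a1) x≡0) z≢0
  ... | inj₂ (_ , x≡q₁) = cong (graph a0 a1) x≡q₁

⊕-meet-sameLine : ∀ {P L L' q} → P ≐ Span (q ∷ []) → proj₁ q ≢ 0F → L ⊆ S → L' ⊆ S →
  (∀ x → L x → L' x → x ≡ 0V) → AtMostOneNonzero ((P ⊕ L) ∩ (P ⊕ L'))
⊕-meet-sameLine {P} {L} {L'} {q} P≐ q₁≢0 L⊆S L'⊆S disjoint = AtMostOneNonzero-intro q ≡q
  where
  ≡q : ∀ {z} → ((P ⊕ L) ∩ (P ⊕ L')) z → z ≢ 0V → z ≡ q
  ≡q (z∈ , z∈') z≢0 with ⊕-split P≐ L⊆S z∈ | ⊕-split P≐ L'⊆S z∈'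
  ... | inj₁ (z∈L , _)      | inj₁ (z∈L' , _)      = contradiction (disjoint _ z∈L z∈L') z≢0
  ... | inj₁ (_ , z₁≡0)     | inj₂ (_ , z₁≡q₁)     = contradiction (trans (sym z₁≡q₁) z₁≡0) q₁≢0
  ... | inj₂ (_ , z₁≡q₁)    | inj₁ (_ , z₁≡0)      = contradiction (trans (sym z₁≡q₁) z₁≡0) q₁≢0
  ... | inj₂ (q+z∈L , _)    | inj₂ (q+z∈L' , _)    =
    sym (+V.inverseˡ-unique _ _ (disjoint _ q+z∈L q+z∈L'))

⊕-∩-⊆ : ∀ {P P' L L' q q'} → P ≐ Span (q ∷ []) → P' ≐ Span (q' ∷ []) →
  proj₁ q ≢ 0F → proj₁ q' ≢ 0F → proj₁ q ≢ proj₁ q' → L ⊆ S → L' ⊆ S →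
  ((P ⊕ L) ∩ (P' ⊕ L')) ⊆ (L ∩ L')
⊕-∩-⊆ P≐ P'≐ q₁≢0 q'₁≢0 q₁≢q'₁ L⊆S L'⊆S _ (z∈ , z∈') with ⊕-split P≐ L⊆S z∈ | ⊕-split P'≐ L'⊆S z∈'
... | inj₁ (z∈L , _)   | inj₁ (z∈L' , _)   = z∈L , z∈L'
... | inj₁ (_ , z₁≡0)  | inj₂ (_ , z₁≡q'₁) = contradiction (trans (sym z₁≡q'₁) z₁≡0) q'₁≢0
... | inj₂ (_ , z₁≡q₁) | inj₁ (_ , z₁≡0)   = contradiction (trans (sym z₁≡q₁) z₁≡0) q₁≢0
... | inj₂ (_ , z₁≡q₁) | inj₂ (_ , z₁≡q'₁) = contradiction (trans (sym z₁≡q₁) z₁≡q'₁) q₁≢q'₁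

module Code (p : Fin 7 → Subset) (Ls : Fin 7 → Fin 5 → Subset)
  (Ls-dim : ∀ i j → HasDim (Ls i j) 2 × Ls i j ⊆ S)
  (spread : ∀ i j j' → j ≢ j' → ∀ x → Ls i j x → Ls i j' x → x ≡ 0V)
  (Ls-distinct : ∀ i j i' j' → (i , j) ≢ (i' , j') → ¬ (Ls i j ≐ Ls i' j'))
  (p-dim : ∀ i → HasDim (p i) 1 × p i ⊆ InV)
  (p⊕S-dim : ∀ i → HasDim (p i ⊕ S) 5)
  (p⊕S-distinct : ∀ i i' → i ≢ i' → ¬ ((p i ⊕ S) ≐ (p i' ⊕ S))) where

  q : Fin 7 → Vect
  q i = proj₁ (HasDim1⇒line (proj₁ (p-dim i)))

  p≐ : ∀ i → p i ≐ Span (q i ∷ [])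
  p≐ i = proj₂ (HasDim1⇒line (proj₁ (p-dim i)))

  q∉S : ∀ i → proj₁ (q i) ≢ 0F
  q∉S i = generator∉S (p≐ i) (p⊕S-dim i)

  Ls⊆S : ∀ i j → Ls i j ⊆ S
  Ls⊆S i j = proj₂ (Ls-dim i j)

  code-dim : ∀ c → HasDim (code p Ls c) 3
  code-dim (inj₁ (a0 , a1)) = G-dim a0 a1
  code-dim (inj₂ (i , j))   = ⊕-dim (p≐ i) (q∉S i) (proj₁ (Ls-dim i j)) (Ls⊆S i j)

  code-⊆InV : ∀ c → code p Ls c ⊆ InV
  code-⊆InV (inj₁ (a0 , a1)) = G-⊆InV a0 a1
  code-⊆InV (inj₂ (i , j))   = ⊕-⊆InV (proj₂ (p-dim i)) (Ls⊆S i j)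

  code-meet : ∀ c c' → c ≢ c' → AtMostOneNonzero (code p Ls c ∩ code p Ls c')
  code-meet (inj₁ (a0 , a1)) (inj₁ (b0 , b1)) c≢c' = G-meet (c≢c' ∘ cong inj₁)
  code-meet (inj₁ (a0 , a1)) (inj₂ (i , j))   _    = G-⊕-meet (p≐ i) (Ls⊆S i j)
  code-meet (inj₂ (i , j))   (inj₁ (a0 , a1)) _    =
    AtMostOneNonzero-∩-comm {G a0 a1} (G-⊕-meet (p≐ i) (Ls⊆S i j))
  code-meet (inj₂ (i , j))   (inj₂ (i' , j')) c≢c' with i Finₚ.≟ i'
  ... | yes refl = ⊕-meet-sameLine (p≐ i) (q∉S i) (Ls⊆S i j) (Ls⊆S i j')
                     (spread i j j' (c≢c' ∘ cong (inj₂ ∘ (i ,_))))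
  ... | no i≢i'  = AtMostOneNonzero-⊆
                     (⊕-∩-⊆ (p≐ i) (p≐ i') (q∉S i) (q∉S i') q₁≢q'₁ (Ls⊆S i j) (Ls⊆S i' j'))
                     (plane-meet (proj₁ (Ls-dim i j)) (proj₁ (Ls-dim i' j'))
                       (Ls-distinct i j i' j' (c≢c' ∘ cong inj₂)))
    where
    q₁≢q'₁ : proj₁ (q i) ≢ proj₁ (q i')
    q₁≢q'₁ = p⊕S-distinct i i' i≢i' ∘ ⊕S-≐ (p≐ i) (p≐ i')

1F : F16
1F = mk true false false false

G-subDist-4 : SubDist (G 0F 0F) (G 1F 1F) 4
G-subDist-4 = subDist-lineMeet (G-dim 0F 0F) (G-dim 1F 1F) (G-meet λ ())
                ((1F , refl , refl) , (1F , refl , refl)) λ ()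

mainTheorem2 : (Ls : Fin 7 → Fin 5 → Subset) →
    (∀ i j → HasDim (Ls i j) 2 × Ls i j ⊆ S) →
    (∀ i j j' → j ≢ j' → ∀ x → Ls i j x → Ls i j' x → x ≡ 0V) →
    (∀ T → HasDim T 2 → T ⊆ S → ∃₂ λ i j → T ≐ Ls i j) →
    (∀ i j i' j' → (i , j) ≢ (i' , j') → ¬ (Ls i j ≐ Ls i' j')) →
    (p : Fin 7 → Subset) →
    (∀ i → HasDim (p i) 1 × p i ⊆ InV) →
    (∀ i → HasDim (p i ⊕ S) 5) →
    (∀ i i' → i ≢ i' → ¬ ((p i ⊕ S) ≐ (p i' ⊕ S))) →
    (∀ c → HasDim (code p Ls c) 3 × code p Ls c ⊆ InV)
    × (∀ c c' → c ≢ c' → ¬ (code p Ls c ≐ code p Ls c'))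
    × (∀ c c' → c ≢ c' → ∃ λ n → SubDist (code p Ls c) (code p Ls c') n × 4 ≤ n)
    × (∃₂ λ c c' → c ≢ c' × SubDist (code p Ls c) (code p Ls c') 4)
mainTheorem2 Ls Ls-dim spread _ Ls-distinct p p-dim p⊕S-dim p⊕S-distinct =
  (λ c → code-dim c , code-⊆InV c) ,
  (λ c c' c≢c' → AtMostOneNonzero⇒≉ (code-dim c) (code-meet c c' c≢c')) ,
  (λ c c' c≢c' → subDist≥4 (code-dim c) (code-dim c') (code-meet c c' c≢c')) ,
  (inj₁ (0F , 0F) , inj₁ (1F , 1F) , (λ ()) , G-subDist-4)
  where open Code p Ls Ls-dim spread Ls-distinct p-dim p⊕S-dim p⊕S-distinct
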